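{- Let $t\geq 2$ and $n$ be positive integers, and let $\mathcal{G}$ be a $K_t$-intersecting family of graphs on the common vertex set $[n]=\{1,\ldots,n\}$, where $K_t$ is the complete graph on $t$ vertices. Then \[ |\mathcal{G}| \leq 2^{\binom{n}{2}-(t-1)}. \]
   Context: All graphs are finite, simple and undirected. A family $\mathcal{G}$ of (distinct) graphs on a common vertex set is called $H$-intersecting if for every two graphs $G_1,G_2\in\mathcal{G}$, the graph $G_1\cap G_2$ (on the common vertex set, with edge set $E(G_1)\cap E(G_2)$) contains a subgraph isomorphic to $H$. -}

module Defs where

open import Data.Nat using (ℕ)
open import Data.Fin using (Fin)
open import Data.Bool using (Bool; true; false)
open import Data.Product using (Σ; _×_)
open import Data.List using (List)
open import Data.List.Membership.Propositional using (_∈_)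
open import Data.List.Relation.Unary.AllPairs using (AllPairs)
open import Relation.Binary.PropositionalEquality using (_≡_; _≢_)
open import Relation.Nullary using (¬_)
open import Function.Definitions using (Injective)

record Graph (n : ℕ) : Set where
  field
    adj    : Fin n → Fin n → Bool
    sym    : ∀ i j → adj i j ≡ adj j i
    irrefl : ∀ i → adj i i ≡ false
open Graph public

SameGraph : ∀ {n} → Graph n → Graph n → Set
SameGraph G H = ∀ i j → adj G i j ≡ adj H i j

DistinctGraphs : ∀ {n} → Graph n → Graph n → Set
DistinctGraphs G H = ¬ SameGraph G H

ContainsKₜInIntersection : ∀ {n} (t : ℕ) → Graph n → Graph n → Set
ContainsKₜInIntersection {n} t G₁ G₂ =
  Σ (Fin t → Fin n) λ f → Injective _≡_ _≡_ f ×
    (∀ a b → a ≢ b → (adj G₁ (f a) (f b) ≡ true) × (adj G₂ (f a) (f b) ≡ true))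

DistinctFamily : ∀ {n} → List (Graph n) → Set
DistinctFamily 𝒢 = AllPairs DistinctGraphs 𝒢

KIntersecting : ∀ {n} (t : ℕ) → List (Graph n) → Set
KIntersecting t 𝒢 = ∀ G₁ G₂ → G₁ ∈ 𝒢 → G₂ ∈ 𝒢 → ContainsKₜInIntersection t G₁ G₂

-- Encode a graph on [n] as a point of the cube {0,1}^E, E the C(n,2) pairs, and 𝒢 as a set F of points.
-- For a colouring P of [n] with c = t - 1 colours, let S_P be the set of monochromatic pairs.  A K_t in
-- G₁ ∩ G₂ has two vertices of the same colour, so any two points of F share a 1 inside S_P; hence the
-- projection of F onto S_P contains no two complementary points and has at most 2^(|S_P| - 1) elements.
-- Each pair is monochromatic under K = c^(n-1) of the c^n colourings, so Shearer's lemma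
-- |F|^K ≤ ∏_P |proj_{S_P} F| yields |F|^K ≤ 2^(K·C(n,2) - c^n), i.e. |F| ≤ 2^(C(n,2) - c).
-- Shearer's lemma is proved by induction on the dimension; the induction step is Hölder's inequality,
-- which reduces to the AM–GM inequality.

module Submission where

open import Defs hiding (sym)
open import Data.Nat using (ℕ; zero; suc; _+_; _*_; _^_; _∸_; _≤_; z≤n; s≤s; NonZero; _≤?_)
open import Data.Nat.Properties hiding (_≟_)
open import Data.Nat.Tactic.RingSolver using (solve-∀)
open import Data.Nat.Combinatorics using (_C_; nC1≡n; nCk+nC[k+1]≡[n+1]C[k+1])
open import Data.Nat.ListAction using (sum; product)
open import Data.Nat.ListAction.Properties using (sum-++)
open import Data.Bool using (Bool; true; false; _∨_; _∧_; not; _xor_)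
open import Data.Bool.Properties using () renaming (_≟_ to _≟ᵇ_)
open import Data.Fin using (Fin; zero; suc; _↑ˡ_; _↑ʳ_; _≟_)
import Data.Fin.Properties as Fin
open import Data.Product using (Σ; _×_; _,_; proj₁; proj₂; uncurry)
import Data.Product as Product
open import Data.Sum using (_⊎_; inj₁; inj₂)
import Data.Sum as Sum
open import Data.Vec using (Vec; []; _∷_; lookup; tail; zipWith)
import Data.Vec as Vec
open import Data.Vec.Properties using (lookup-zipWith; ≡-dec; lookup-map; lookup-++ˡ; lookup-++ʳ; lookup∘tabulate)
import Data.Vec.Relation.Unary.All as VecAll
import Data.Vec.Relation.Unary.All.Properties as VecAll
open import Data.List using (List; []; _∷_; _++_; length; map; concat; tabulate)
open import Data.List.Properties using (length-map; map-++; map-∘; map-cong; tabulate-cong)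
open import Data.List.Relation.Unary.Any using (any?)
open import Data.List.Relation.Unary.All using (All; []; _∷_)
import Data.List.Relation.Unary.All as All
import Data.List.Relation.Unary.All.Properties as All
import Data.List.Relation.Unary.AllPairs as AllPairs
import Data.List.Relation.Unary.AllPairs.Properties as AllPairs
open import Data.List.Membership.Propositional.Properties using (∈-map⁻)
open import Data.List.Relation.Unary.All.Properties using (All¬⇒¬Any)
open import Data.List.Relation.Unary.AllPairs using ([]; _∷_)
open import Data.List.Relation.Unary.Unique.Propositional using (Unique)
open import Data.List.Membership.Propositional using (_∈_)
open import Relation.Binary.PropositionalEquality
open import Relation.Binary.Definitions using (DecidableEquality)
open import Relation.Nullary using (yes; no; does)
open import Relation.Nullary.Decidable using (dec-true)
open import Data.Empty using (⊥-elim)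
open import Function using (_∘_)

-- Inequalities between natural numbers

^-distrib-* : ∀ m n k → (m * n) ^ k ≡ m ^ k * n ^ k
^-distrib-* m n zero    = refl
^-distrib-* m n (suc k) = begin
  m * n * (m * n) ^ k      ≡⟨ cong (m * n *_) (^-distrib-* m n k) ⟩
  m * n * (m ^ k * n ^ k)  ≡⟨ [m*n]*[o*p]≡[m*o]*[n*p] m n (m ^ k) (n ^ k) ⟩
  m * m ^ k * (n * n ^ k)  ∎
  where open ≡-Reasoning

^-cancelʳ-≤ : ∀ k .{{_ : NonZero k}} m n → m ^ k ≤ n ^ k → m ≤ n
^-cancelʳ-≤ k m n mᵏ≤nᵏ with m ≤? n
... | yes m≤n = m≤n
... | no  m≰n = ⊥-elim (<⇒≱ (^-monoˡ-< k (≰⇒> m≰n)) mᵏ≤nᵏ)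

rearrangement-≤ : ∀ j {a b} → a ≤ b → a * b ^ j + b * a ^ j ≤ a * a ^ j + b * b ^ j
rearrangement-≤ j {a} a≤b with m≤n⇒∃[o]m+o≡n a≤b | m≤n⇒∃[o]m+o≡n (^-monoˡ-≤ j a≤b)
... | d , refl | e , aʲ+e≡bʲ = begin
  a * (a + d) ^ j + (a + d) * a ^ j         ≡⟨ cong (λ w → a * w + (a + d) * a ^ j) (sym aʲ+e≡bʲ) ⟩
  a * (a ^ j + e) + (a + d) * a ^ j         ≤⟨ m≤m+n _ (d * e) ⟩
  a * (a ^ j + e) + (a + d) * a ^ j + d * e ≡⟨ shuffle a d (a ^ j) e ⟩
  a * a ^ j + (a + d) * (a ^ j + e)         ≡⟨ cong (λ w → a * a ^ j + (a + d) * w) aʲ+e≡bʲ ⟩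
  a * a ^ j + (a + d) * (a + d) ^ j         ∎
  where
  open ≤-Reasoning
  shuffle : ∀ a d p e → a * (p + e) + (a + d) * p + d * e ≡ a * p + (a + d) * (p + e)
  shuffle = solve-∀

rearrangement : ∀ j a b → a * b ^ j + b * a ^ j ≤ a * a ^ j + b * b ^ j
rearrangement j a b with ≤-total a b
... | inj₁ a≤b = rearrangement-≤ j a≤b
... | inj₂ b≤a = begin
  a * b ^ j + b * a ^ j ≡⟨ +-comm (a * b ^ j) _ ⟩
  b * a ^ j + a * b ^ j ≤⟨ rearrangement-≤ j b≤a ⟩
  b * b ^ j + a * a ^ j ≡⟨ +-comm (b * b ^ j) _ ⟩
  a * a ^ j + b * b ^ j ∎
  where open ≤-Reasoning

young : ∀ k a b → suc k * (a ^ k * b) ≤ b ^ suc k + k * a ^ suc k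
young zero    a b = ≤-reflexive (base a b)
  where
  base : ∀ a b → 1 * (1 * b) ≡ b * 1 + 0 * (a * 1)
  base = solve-∀
young (suc k) a b = begin
  suc (suc k) * (a * a ^ k * b)                                 ≡⟨ e₁ k (a ^ k) b a ⟩
  a * (suc k * (a ^ k * b)) + b * (a * a ^ k)                   ≤⟨ +-monoˡ-≤ _ (*-monoʳ-≤ a (young k a b)) ⟩
  a * (b * b ^ k + k * (a * a ^ k)) + b * (a * a ^ k)           ≡⟨ e₂ k a b (b ^ k) (a ^ k) ⟩
  (a * (b * b ^ k) + b * (a * a ^ k)) + k * (a * (a * a ^ k))   ≤⟨ +-monoˡ-≤ _ (rearrangement (suc k) a b) ⟩
  (a * (a * a ^ k) + b * (b * b ^ k)) + k * (a * (a * a ^ k))   ≡⟨ e₃ k a b (b ^ k) (a ^ k) ⟩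
  b * (b * b ^ k) + suc k * (a * (a * a ^ k))                   ∎
  where
  open ≤-Reasoning
  e₁ : ∀ k p b a → suc (suc k) * (a * p * b) ≡ a * (suc k * (p * b)) + b * (a * p)
  e₁ = solve-∀
  e₂ : ∀ k a b q p → a * (b * q + k * (a * p)) + b * (a * p) ≡ (a * (b * q) + b * (a * p)) + k * (a * (a * p))
  e₂ = solve-∀
  e₃ : ∀ k a b q p → (a * (a * p) + b * (b * q)) + k * (a * (a * p)) ≡ b * (b * q) + suc k * (a * (a * p))
  e₃ = solve-∀

-- Young's inequality at a = (K + 1) S, b = K (z + S), divided by K.
amgm-step : ∀ k z S → let K = suc k in suc K ^ suc K * z * S ^ K ≤ K ^ K * (z + S) ^ suc K
amgm-step k z S = +-cancelʳ-≤ (sK * α * σ * S) _ _ (begin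
  sK * α * z * σ + sK * α * σ * S  ≡⟨ e₃ sK α σ z S ⟩
  sK * α * σ * T                   ≤⟨ *-cancelˡ-≤ K (begin
    K * (sK * α * σ * T)                         ≡⟨ e₁ K sK S T α σ ⟩
    sK * ((α * σ) * (K * T))                     ≡⟨ cong (λ w → sK * (w * (K * T))) (sym (^-distrib-* sK S K)) ⟩
    sK * ((sK * S) ^ K * (K * T))                ≤⟨ young K (sK * S) (K * T) ⟩
    (K * T) ^ sK + K * (sK * S) ^ sK             ≡⟨ cong₂ (λ w w′ → (K * T) * w + K * ((sK * S) * w′))
                                                          (^-distrib-* K T K) (^-distrib-* sK S K) ⟩
    (K * T) * (κ * τ) + K * ((sK * S) * (α * σ)) ≡⟨ e₂ K sK S T α σ κ τ ⟩
    K * (T * κ * τ + sK * S * α * σ)             ∎) ⟩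
  T * κ * τ + sK * S * α * σ       ≡⟨ e₄ sK S α σ T κ τ ⟩
  κ * (T * τ) + sK * α * σ * S     ∎)
  where
  open ≤-Reasoning
  K = suc k
  sK = suc K
  T = z + S
  α = sK ^ K
  σ = S ^ K
  κ = K ^ K
  τ = T ^ K
  e₁ : ∀ K sK S T α σ → K * (sK * α * σ * T) ≡ sK * ((α * σ) * (K * T))
  e₁ = solve-∀
  e₂ : ∀ K sK S T α σ κ τ → (K * T) * (κ * τ) + K * ((sK * S) * (α * σ)) ≡ K * (T * κ * τ + sK * S * α * σ)
  e₂ = solve-∀
  e₃ : ∀ sK α σ z S → sK * α * z * σ + sK * α * σ * S ≡ sK * α * σ * (z + S)
  e₃ = solve-∀
  e₄ : ∀ sK S α σ T κ τ → T * κ * τ + sK * S * α * σ ≡ κ * (T * τ) + sK * α * σ * S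
  e₄ = solve-∀

amgm : ∀ zs → length zs ^ length zs * product zs ≤ sum zs ^ length zs
amgm []                = ≤-refl
amgm (z ∷ [])          = ≤-reflexive (singleton z)
  where
  singleton : ∀ z → 1 * (z * 1) ≡ (z + 0) * 1
  singleton = solve-∀
amgm (z ∷ zs@(w ∷ ws)) = *-cancelˡ-≤ (K ^ K) {{m^n≢0 K K}} (begin
  K ^ K * (suc K ^ suc K * (z * product zs)) ≡⟨ e (suc K ^ suc K) (K ^ K) z (product zs) ⟩
  suc K ^ suc K * z * (K ^ K * product zs)   ≤⟨ *-monoʳ-≤ (suc K ^ suc K * z) (amgm zs) ⟩
  suc K ^ suc K * z * sum zs ^ K             ≤⟨ amgm-step (length ws) z (sum zs) ⟩
  K ^ K * (z + sum zs) ^ suc K               ∎)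
  where
  open ≤-Reasoning
  K = length zs
  e : ∀ a b z p → b * (a * (z * p)) ≡ a * z * (b * p)
  e = solve-∀

-- X ^ k * M ≤ Q * u ^ k says X ≤ u · (Q / M) ^ (1 / k); such bounds add up.
^-ratio-+-ordered : ∀ k M Q {X Y u v} → Y * u ≤ X * v → X ^ k * M ≤ Q * u ^ k → Y ^ k * M ≤ Q * v ^ k →
                    (X + Y) ^ k * M ≤ Q * (u + v) ^ k
^-ratio-+-ordered zero    M Q {u = zero} _ hX _ = hX
^-ratio-+-ordered (suc k) M Q {X} {Y} {u = zero} _ hX hY
  with m*n≡0⇒m≡0∨n≡0 (X ^ suc k) (n≤0⇒n≡0 (≤-trans hX (≤-reflexive (*-zeroʳ Q))))
... | inj₂ refl = ≤-trans (≤-reflexive (*-zeroʳ ((X + Y) ^ suc k))) z≤n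
... | inj₁ Xᵏ≡0 rewrite m^n≡0⇒m≡0 X (suc k) Xᵏ≡0 = hY
^-ratio-+-ordered k M Q {X} {Y} {u@(suc _)} {v} Yu≤Xv hX _ = *-cancelˡ-≤ (u ^ k) {{m^n≢0 u k}} (begin
  u ^ k * ((X + Y) ^ k * M)  ≡⟨ e₁ (u ^ k) ((X + Y) ^ k) M ⟩
  ((X + Y) ^ k * u ^ k) * M  ≡⟨ cong (_* M) (sym (^-distrib-* (X + Y) u k)) ⟩
  ((X + Y) * u) ^ k * M      ≤⟨ *-monoˡ-≤ M (^-monoˡ-≤ k linear) ⟩
  (X * (u + v)) ^ k * M      ≡⟨ cong (_* M) (^-distrib-* X (u + v) k) ⟩
  (X ^ k * (u + v) ^ k) * M  ≡⟨ e₂ (X ^ k) ((u + v) ^ k) M ⟩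
  (u + v) ^ k * (X ^ k * M)  ≤⟨ *-monoʳ-≤ ((u + v) ^ k) hX ⟩
  (u + v) ^ k * (Q * u ^ k)  ≡⟨ e₃ ((u + v) ^ k) Q (u ^ k) ⟩
  u ^ k * (Q * (u + v) ^ k)  ∎)
  where
  open ≤-Reasoning
  linear : (X + Y) * u ≤ X * (u + v)
  linear = begin
    (X + Y) * u   ≡⟨ *-distribʳ-+ u X Y ⟩
    X * u + Y * u ≤⟨ +-monoʳ-≤ (X * u) Yu≤Xv ⟩
    X * u + X * v ≡⟨ *-distribˡ-+ X u v ⟨
    X * (u + v)   ∎
  e₁ : ∀ a b c → a * (b * c) ≡ (b * a) * c
  e₁ = solve-∀
  e₂ : ∀ a b c → (a * b) * c ≡ b * (a * c)
  e₂ = solve-∀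
  e₃ : ∀ a b c → a * (b * c) ≡ c * (b * a)
  e₃ = solve-∀

^-ratio-+ : ∀ k M Q {X Y u v} → X ^ k * M ≤ Q * u ^ k → Y ^ k * M ≤ Q * v ^ k →
            (X + Y) ^ k * M ≤ Q * (u + v) ^ k
^-ratio-+ k M Q {X} {Y} {u} {v} hX hY with ≤-total (Y * u) (X * v)
... | inj₁ Yu≤Xv = ^-ratio-+-ordered k M Q Yu≤Xv hX hY
... | inj₂ Xv≤Yu rewrite +-comm X Y | +-comm u v = ^-ratio-+-ordered k M Q Xv≤Yu hY hX

sum-map-* : ∀ c xs → sum (map (c *_) xs) ≡ c * sum xs
sum-map-* c []       = sym (*-zeroʳ c)
sum-map-* c (x ∷ xs) = trans (cong (c * x +_) (sum-map-* c xs)) (sym (*-distribˡ-+ c x (sum xs)))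

product-map-* : ∀ c xs → product (map (c *_) xs) ≡ c ^ length xs * product xs
product-map-* c []       = refl
product-map-* c (x ∷ xs) = begin
  c * x * product (map (c *_) xs)      ≡⟨ cong (c * x *_) (product-map-* c xs) ⟩
  c * x * (c ^ length xs * product xs) ≡⟨ [m*n]*[o*p]≡[m*o]*[n*p] c x _ _ ⟩
  c * c ^ length xs * (x * product xs) ∎
  where open ≡-Reasoning

total : ℕ × ℕ → ℕ
total (a , b) = a + b

-- The i-th weight is f pᵢ * ∏_{j ≠ i} total pⱼ.
weights : (ℕ × ℕ → ℕ) → List (ℕ × ℕ) → List ℕ
weights f []       = []
weights f (p ∷ ps) = f p * product (map total ps) ∷ map (total p *_) (weights f ps)

length-weights : ∀ f ps → length (weights f ps) ≡ length ps
length-weights f []       = refl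
length-weights f (p ∷ ps) = cong suc (trans (length-map _ (weights f ps)) (length-weights f ps))

sum-weights : ∀ ps → sum (weights proj₁ ps) + sum (weights proj₂ ps) ≡ length ps * product (map total ps)
sum-weights []             = refl
sum-weights ((a , b) ∷ ps) = begin
  (a * P + sum (map ((a + b) *_) (weights proj₁ ps))) + (b * P + sum (map ((a + b) *_) (weights proj₂ ps)))
    ≡⟨ cong₂ (λ u v → (a * P + u) + (b * P + v)) (sum-map-* (a + b) (weights proj₁ ps)) (sum-map-* (a + b) (weights proj₂ ps)) ⟩
  (a * P + (a + b) * u) + (b * P + (a + b) * v) ≡⟨ e₁ a b P u v ⟩
  (a + b) * P + (a + b) * (u + v)               ≡⟨ cong (λ w → (a + b) * P + (a + b) * w) (sum-weights ps) ⟩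
  (a + b) * P + (a + b) * (length ps * P)       ≡⟨ e₂ (a + b) P (length ps) ⟩
  suc (length ps) * ((a + b) * P)               ∎
  where
  open ≡-Reasoning
  P = product (map total ps)
  u = sum (weights proj₁ ps)
  v = sum (weights proj₂ ps)
  e₁ : ∀ a b P u v → (a * P + (a + b) * u) + (b * P + (a + b) * v) ≡ (a + b) * P + (a + b) * (u + v)
  e₁ = solve-∀
  e₂ : ∀ w P l → w * P + w * (l * P) ≡ suc l * (w * P)
  e₂ = solve-∀

product-weights : ∀ f ps → product (map total ps) * product (weights f ps) ≡
                           product (map f ps) * product (map total ps) ^ length ps
product-weights f []       = refl
product-weights f (p ∷ ps) = begin
  (W * P) * (f p * P * product (map (W *_) (weights f ps)))   ≡⟨ cong (λ x → (W * P) * (f p * P * x)) scale ⟩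
  (W * P) * (f p * P * (W ^ k * product (weights f ps)))      ≡⟨ e₁ W P (f p) (W ^ k) _ ⟩
  f p * W * W ^ k * P * (P * product (weights f ps))          ≡⟨ cong (f p * W * W ^ k * P *_) (product-weights f ps) ⟩
  f p * W * W ^ k * P * (product (map f ps) * P ^ k)          ≡⟨ e₂ (f p) W (W ^ k) _ P (P ^ k) ⟩
  (f p * product (map f ps)) * ((W * P) * (W ^ k * P ^ k))    ≡⟨ cong (λ x → (f p * product (map f ps)) * ((W * P) * x)) (^-distrib-* W P k) ⟨
  (f p * product (map f ps)) * ((W * P) * (W * P) ^ k)        ∎
  where
  open ≡-Reasoning
  W = total p
  P = product (map total ps)
  k = length ps
  scale : product (map (W *_) (weights f ps)) ≡ W ^ k * product (weights f ps)
  scale = begin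
    product (map (W *_) (weights f ps))                ≡⟨ product-map-* W (weights f ps) ⟩
    W ^ length (weights f ps) * product (weights f ps) ≡⟨ cong (λ l → W ^ l * product (weights f ps)) (length-weights f ps) ⟩
    W ^ k * product (weights f ps)                     ∎
  e₁ : ∀ W P a w z → (W * P) * (a * P * (w * z)) ≡ a * W * w * P * (P * z)
  e₁ = solve-∀
  e₂ : ∀ a W w A P p → a * W * w * P * (A * p) ≡ (a * A) * ((W * P) * (w * p))
  e₂ = solve-∀

product-total≡0 : ∀ ps → product (map total ps) ≡ 0 →
                  product (map proj₁ ps) ≡ 0 × product (map proj₂ ps) ≡ 0
product-total≡0 ((a , b) ∷ ps) eq with m*n≡0⇒m≡0∨n≡0 (a + b) eq
... | inj₁ a+b≡0 rewrite m+n≡0⇒m≡0 a a+b≡0 | m+n≡0⇒n≡0 a a+b≡0 = refl , refl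
... | inj₂ P≡0 with product-total≡0 ps P≡0
...   | A≡0 , B≡0 rewrite A≡0 | B≡0 = *-zeroʳ a , *-zeroʳ b

-- Hölder's inequality ∏ aᵢ^(1/k) + ∏ bᵢ^(1/k) ≤ ∏ (aᵢ + bᵢ)^(1/k), with k = length ps.
holder : ∀ ps {x y} M D → x ^ length ps * M ≤ product (map proj₁ ps) * D →
                          y ^ length ps * M ≤ product (map proj₂ ps) * D →
         (x + y) ^ length ps * M ≤ product (map total ps) * D
holder []              M D hx hy = hx
holder ps@(_ ∷ _) {x} {y} M D hx hy with product (map total ps) in W≡P
... | zero = ^-ratio-+ (length ps) M 0 {x} {y} {1} {1}
               (subst (λ A → x ^ length ps * M ≤ A * D) (proj₁ (product-total≡0 ps W≡P)) hx)
               (subst (λ B → y ^ length ps * M ≤ B * D) (proj₂ (product-total≡0 ps W≡P)) hy)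
... | P@(suc _) = *-cancelˡ-≤ ((k * P) ^ k) {{m^n≢0 (k * P) k}} (begin
  (k * P) ^ k * ((x + y) ^ k * M)   ≡⟨ *-assoc ((k * P) ^ k) _ M ⟨
  ((k * P) ^ k * (x + y) ^ k) * M   ≡⟨ cong (_* M) (^-distrib-* (k * P) (x + y) k) ⟨
  (k * P * (x + y)) ^ k * M         ≡⟨ cong (λ w → w ^ k * M) (*-distribˡ-+ (k * P) x y) ⟩
  (k * P * x + k * P * y) ^ k * M   ≤⟨ ^-ratio-+ k M (D * P) {k * P * x} {k * P * y} {u} {v}
                                                  (amgm-bound proj₁ {x} hx) (amgm-bound proj₂ {y} hy) ⟩
  D * P * (u + v) ^ k               ≡⟨ cong (λ w → D * P * w ^ k) (trans (sum-weights ps) (cong (k *_) W≡P)) ⟩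
  D * P * (k * P) ^ k               ≡⟨ e₁ D P ((k * P) ^ k) ⟩
  (k * P) ^ k * (P * D)             ∎)
  where
  open ≤-Reasoning
  k = length ps
  u = sum (weights proj₁ ps)
  v = sum (weights proj₂ ps)
  e₁ : ∀ D P q → D * P * q ≡ q * (P * D)
  e₁ = solve-∀
  -- AM–GM on the weights (P · ∏ weights = ∏ aᵢ · P ^ k) bounds k P x against their sum u; the bounds
  -- for x and y then add up, and u + v = k P.
  amgm-bound : ∀ f {z} → z ^ k * M ≤ product (map f ps) * D →
               (k * P * z) ^ k * M ≤ (D * P) * sum (weights f ps) ^ k
  amgm-bound f {z} h = begin
    (k * P * z) ^ k * M                     ≡⟨ cong (_* M) (trans (^-distrib-* (k * P) z k)
                                                                  (cong (_* z ^ k) (^-distrib-* k P k))) ⟩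
    k ^ k * P ^ k * z ^ k * M               ≡⟨ *-assoc (k ^ k * P ^ k) (z ^ k) M ⟩
    k ^ k * P ^ k * (z ^ k * M)             ≤⟨ *-monoʳ-≤ (k ^ k * P ^ k) h ⟩
    k ^ k * P ^ k * (A * D)                 ≡⟨ e₂ (k ^ k) (P ^ k) A D ⟩
    D * (k ^ k * (A * P ^ k))               ≡⟨ cong (λ w → D * (k ^ k * w)) weights-product ⟨
    D * (k ^ k * (P * product zs))          ≡⟨ e₃ D (k ^ k) P (product zs) ⟩
    (D * P) * (k ^ k * product zs)          ≡⟨ cong (λ l → (D * P) * (l ^ l * product zs)) (length-weights f ps) ⟨
    (D * P) * (length zs ^ length zs * product zs) ≤⟨ *-monoʳ-≤ (D * P) (amgm zs) ⟩
    (D * P) * (sum zs ^ length zs)          ≡⟨ cong (λ l → (D * P) * (sum zs ^ l)) (length-weights f ps) ⟩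
    (D * P) * sum zs ^ k                    ∎
    where
    A = product (map f ps)
    zs = weights f ps
    weights-product : P * product zs ≡ A * P ^ k
    weights-product = subst (λ Q → Q * product zs ≡ A * Q ^ k) W≡P (product-weights f ps)
    e₂ : ∀ a b A D → a * b * (A * D) ≡ D * (a * (A * b))
    e₂ = solve-∀
    e₃ : ∀ D a P p → D * (a * (P * p)) ≡ (D * P) * (a * p)
    e₃ = solve-∀

*-2^-≤⇒≤-2^∸ : ∀ X c m → X * 2 ^ c ≤ 2 ^ m → X ≤ 2 ^ (m ∸ c)
*-2^-≤⇒≤-2^∸ X c m X2ᶜ≤2ᵐ with c ≤? m
... | yes c≤m = *-cancelʳ-≤ X (2 ^ (m ∸ c)) (2 ^ c) {{m^n≢0 2 c}} (begin
  X * 2 ^ c             ≤⟨ X2ᶜ≤2ᵐ ⟩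
  2 ^ m                 ≡⟨ cong (2 ^_) (m∸n+n≡m c≤m) ⟨
  2 ^ (m ∸ c + c)       ≡⟨ ^-distribˡ-+-* 2 (m ∸ c) c ⟩
  2 ^ (m ∸ c) * 2 ^ c   ∎)
  where open ≤-Reasoning
... | no c≰m with X
...   | zero   = z≤n
...   | suc X′ = ⊥-elim (<⇒≱ (^-monoʳ-< 2 (s≤s (s≤s z≤n)) (≰⇒> c≰m)) (≤-trans (m≤m+n (2 ^ c) (X′ * 2 ^ c)) X2ᶜ≤2ᵐ))

^-*-2^-≤⇒≤-2^∸ : ∀ K .{{_ : NonZero K}} X c m → X ^ K * 2 ^ (c * K) ≤ 2 ^ (m * K) → X ≤ 2 ^ (m ∸ c)
^-*-2^-≤⇒≤-2^∸ K X c m h = *-2^-≤⇒≤-2^∸ X c m (^-cancelʳ-≤ K (X * 2 ^ c) (2 ^ m) (begin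
  (X * 2 ^ c) ^ K      ≡⟨ ^-distrib-* X (2 ^ c) K ⟩
  X ^ K * (2 ^ c) ^ K  ≡⟨ cong (X ^ K *_) (^-*-assoc 2 c K) ⟩
  X ^ K * 2 ^ (c * K)  ≤⟨ h ⟩
  2 ^ (m * K)          ≡⟨ ^-*-assoc 2 m K ⟨
  (2 ^ m) ^ K          ∎))
  where open ≤-Reasoning

-- The Boolean cube

𝟙 : Bool → ℕ
𝟙 true  = 1
𝟙 false = 0

𝟙-∨ˡ : ∀ a b → 𝟙 a ≤ 𝟙 (a ∨ b)
𝟙-∨ˡ true  b = ≤-refl
𝟙-∨ˡ false b = z≤n

𝟙-∨ʳ : ∀ a b → 𝟙 b ≤ 𝟙 (a ∨ b)
𝟙-∨ʳ true  true  = ≤-refl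
𝟙-∨ʳ true  false = z≤n
𝟙-∨ʳ false b     = ≤-refl

𝟙-∨-disjoint : ∀ a b → a ∧ b ≡ false → 𝟙 (a ∨ b) ≡ 𝟙 a + 𝟙 b
𝟙-∨-disjoint true  false _ = refl
𝟙-∨-disjoint false b     _ = refl

sumCube : ∀ m → (Vec Bool m → ℕ) → ℕ
sumCube zero    f = f []
sumCube (suc m) f = sumCube m (λ x → f (false ∷ x)) + sumCube m (λ x → f (true ∷ x))

count : ∀ {m} → (Vec Bool m → Bool) → ℕ
count {m} F = sumCube m (λ x → 𝟙 (F x))

sumCube-mono : ∀ m {f g : Vec Bool m → ℕ} → (∀ x → f x ≤ g x) → sumCube m f ≤ sumCube m g
sumCube-mono zero    f≤g = f≤g []
sumCube-mono (suc m) f≤g = +-mono-≤ (sumCube-mono m (λ x → f≤g (false ∷ x))) (sumCube-mono m (λ x → f≤g (true ∷ x)))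

sumCube-cong : ∀ m {f g : Vec Bool m → ℕ} → (∀ x → f x ≡ g x) → sumCube m f ≡ sumCube m g
sumCube-cong m f≡g = ≤-antisym (sumCube-mono m (λ x → ≤-reflexive (f≡g x))) (sumCube-mono m (λ x → ≤-reflexive (sym (f≡g x))))

sumCube-+ : ∀ m (f g : Vec Bool m → ℕ) → sumCube m (λ x → f x + g x) ≡ sumCube m f + sumCube m g
sumCube-+ zero    f g = refl
sumCube-+ (suc m) f g = begin
  sumCube m (λ x → f (false ∷ x) + g (false ∷ x)) + sumCube m (λ x → f (true ∷ x) + g (true ∷ x))
    ≡⟨ cong₂ _+_ (sumCube-+ m _ _) (sumCube-+ m _ _) ⟩
  (f₀ + g₀) + (f₁ + g₁) ≡⟨ +-assoc f₀ g₀ (f₁ + g₁) ⟩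
  f₀ + (g₀ + (f₁ + g₁)) ≡⟨ cong (f₀ +_) (+-comm g₀ (f₁ + g₁)) ⟩
  f₀ + ((f₁ + g₁) + g₀) ≡⟨ cong (f₀ +_) (+-assoc f₁ g₁ g₀) ⟩
  f₀ + (f₁ + (g₁ + g₀)) ≡⟨ +-assoc f₀ f₁ (g₁ + g₀) ⟨
  (f₀ + f₁) + (g₁ + g₀) ≡⟨ cong ((f₀ + f₁) +_) (+-comm g₁ g₀) ⟩
  (f₀ + f₁) + (g₀ + g₁) ∎
  where
  open ≡-Reasoning
  f₀ = sumCube m (λ x → f (false ∷ x))
  f₁ = sumCube m (λ x → f (true ∷ x))
  g₀ = sumCube m (λ x → g (false ∷ x))
  g₁ = sumCube m (λ x → g (true ∷ x))

sumCube-const : ∀ m k → sumCube m (λ _ → k) ≡ 2 ^ m * k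
sumCube-const zero    k = sym (+-identityʳ k)
sumCube-const (suc m) k = begin
  sumCube m (λ _ → k) + sumCube m (λ _ → k) ≡⟨ cong₂ _+_ (sumCube-const m k) (sumCube-const m k) ⟩
  2 ^ m * k + 2 ^ m * k                     ≡⟨ *-distribʳ-+ k (2 ^ m) (2 ^ m) ⟨
  (2 ^ m + 2 ^ m) * k                       ≡⟨ cong (λ w → (2 ^ m + w) * k) (+-identityʳ (2 ^ m)) ⟨
  2 * 2 ^ m * k                             ∎
  where open ≡-Reasoning

sumCube-0 : ∀ m → sumCube m (λ _ → 0) ≡ 0
sumCube-0 m = trans (sumCube-const m 0) (*-zeroʳ (2 ^ m))

flipOn : ∀ {m} → Vec Bool m → Vec Bool m → Vec Bool m
flipOn = zipWith _xor_

sumCube-flipOn : ∀ m (S : Vec Bool m) f → sumCube m (λ x → f (flipOn S x)) ≡ sumCube m f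
sumCube-flipOn zero    []          f = refl
sumCube-flipOn (suc m) (false ∷ S) f =
  cong₂ _+_ (sumCube-flipOn m S (λ x → f (false ∷ x))) (sumCube-flipOn m S (λ x → f (true ∷ x)))
sumCube-flipOn (suc m) (true ∷ S)  f =
  trans (cong₂ _+_ (sumCube-flipOn m S (λ x → f (true ∷ x))) (sumCube-flipOn m S (λ x → f (false ∷ x))))
        (+-comm (sumCube m (λ x → f (true ∷ x))) _)

count-antipodal-free : ∀ {m} (S : Vec Bool m) (g : Vec Bool m → Bool) →
                       (∀ x → g x ∧ g (flipOn S x) ≡ false) → 2 * count g ≤ 2 ^ m
count-antipodal-free {m} S g antipodal-free = begin
  2 * count g                                     ≡⟨ cong (count g +_) (+-identityʳ (count g)) ⟩
  count g + count g                               ≡⟨ cong (count g +_) (sumCube-flipOn m S (λ x → 𝟙 (g x))) ⟨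
  count g + sumCube m (λ x → 𝟙 (g (flipOn S x)))  ≡⟨ sumCube-+ m (λ x → 𝟙 (g x)) _ ⟨
  sumCube m (λ x → 𝟙 (g x) + 𝟙 (g (flipOn S x)))  ≡⟨ sumCube-cong m (λ x → 𝟙-∨-disjoint (g x) (g (flipOn S x))
                                                                                        (antipodal-free x)) ⟨
  sumCube m (λ x → 𝟙 (g x ∨ g (flipOn S x)))      ≤⟨ sumCube-mono m (λ x → 𝟙≤1 (g x ∨ g (flipOn S x))) ⟩
  sumCube m (λ _ → 1)                             ≡⟨ sumCube-const m 1 ⟩
  2 ^ m * 1                                       ≡⟨ *-identityʳ (2 ^ m) ⟩
  2 ^ m                                           ∎
  where
  open ≤-Reasoning
  𝟙≤1 : ∀ b → 𝟙 b ≤ 1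
  𝟙≤1 true  = ≤-refl
  𝟙≤1 false = z≤n

-- cylinder S F is the set of points agreeing on S (the coordinates i with Sᵢ = true) with some point of F,
-- i.e. the projection of F onto S, extended freely in the other coordinates.
cylinder : ∀ {m} → Vec Bool m → (Vec Bool m → Bool) → Vec Bool m → Bool
cylinder []          F []      = F []
cylinder (true ∷ S)  F (b ∷ x) = cylinder S (λ z → F (b ∷ z)) x
cylinder (false ∷ S) F (b ∷ x) = cylinder S (λ z → F (false ∷ z)) x ∨ cylinder S (λ z → F (true ∷ z)) x

AgreeOn : ∀ {m} → Vec Bool m → Vec Bool m → Vec Bool m → Set
AgreeOn S z x = ∀ i → lookup S i ≡ true → lookup z i ≡ lookup x i

cylinder-witness : ∀ {m} S (F : Vec Bool m → Bool) x → cylinder S F x ≡ true →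
                   Σ (Vec Bool m) λ z → F z ≡ true × AgreeOn S z x
cylinder-witness []          F []      Fx = [] , Fx , λ ()
cylinder-witness (true ∷ S)  F (b ∷ x) cx with cylinder-witness S (λ z → F (b ∷ z)) x cx
... | z , Fz , agree = b ∷ z , Fz , λ { zero _ → refl ; (suc i) Sᵢ → agree i Sᵢ }
cylinder-witness (false ∷ S) F (b ∷ x) cx with cylinder S (λ z → F (false ∷ z)) x in c₀
... | true  with cylinder-witness S (λ z → F (false ∷ z)) x c₀
...   | z , Fz , agree = false ∷ z , Fz , λ { (suc i) Sᵢ → agree i Sᵢ }
cylinder-witness (false ∷ S) F (b ∷ x) cx | false with cylinder-witness S (λ z → F (true ∷ z)) x cx
...   | z , Fz , agree = true ∷ z , Fz , λ { (suc i) Sᵢ → agree i Sᵢ }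

IntersectingOn : ∀ {m} → Vec Bool m → (Vec Bool m → Bool) → Set
IntersectingOn {m} S F = ∀ z z′ → F z ≡ true → F z′ ≡ true →
  Σ (Fin m) λ i → lookup S i ≡ true × lookup z i ≡ true × lookup z′ i ≡ true

cylinder-antipodal-free : ∀ {m} (S : Vec Bool m) F → IntersectingOn S F →
                          ∀ x → cylinder S F x ∧ cylinder S F (flipOn S x) ≡ false
cylinder-antipodal-free S F intersecting x with cylinder S F x in c | cylinder S F (flipOn S x) in c′
... | false | _     = refl
... | true  | false = refl
... | true  | true
  with cylinder-witness S F x c | cylinder-witness S F (flipOn S x) c′
...   | z , Fz , z≈x | z′ , Fz′ , z′≈x′ with intersecting z z′ Fz Fz′
...     | i , Sᵢ , zᵢ , z′ᵢ = ⊥-elim (false≢true (begin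
  false                             ≡⟨ cong not (trans (sym (z≈x i Sᵢ)) zᵢ) ⟨
  not (lookup x i)                  ≡⟨ cong (_xor lookup x i) Sᵢ ⟨
  lookup S i xor lookup x i         ≡⟨ lookup-zipWith _xor_ i S x ⟨
  lookup (flipOn S x) i             ≡⟨ z′≈x′ i Sᵢ ⟨
  lookup z′ i                       ≡⟨ z′ᵢ ⟩
  true                              ∎))
  where
  open ≡-Reasoning
  false≢true : false ≢ true
  false≢true ()

count-cylinder-intersecting : ∀ {m} (S : Vec Bool m) F → IntersectingOn S F → 2 * count (cylinder S F) ≤ 2 ^ m
count-cylinder-intersecting S F intersecting = count-antipodal-free S (cylinder S F) (cylinder-antipodal-free S F intersecting)

_≟ᵛ_ : ∀ {m} → DecidableEquality (Vec Bool m)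
_≟ᵛ_ = ≡-dec _≟ᵇ_

memberOf : ∀ {m} → List (Vec Bool m) → Vec Bool m → Bool
memberOf L x = does (any? (x ≟ᵛ_) L)

memberOf-sound : ∀ {m} L (x : Vec Bool m) → memberOf L x ≡ true → x ∈ L
memberOf-sound L x _ with any? (x ≟ᵛ_) L
... | yes x∈L = x∈L

count-point : ∀ {m} (v : Vec Bool m) → count (λ x → does (x ≟ᵛ v)) ≡ 1
count-point []                  = refl
count-point {suc m} (false ∷ v) = cong₂ _+_ (count-point v) (sumCube-0 m)
count-point {suc m} (true ∷ v)  = cong₂ _+_ (sumCube-0 m) (count-point v)

count-memberOf : ∀ {m} (L : List (Vec Bool m)) → Unique L → count (memberOf L) ≡ length L
count-memberOf {m} []      []             = sumCube-0 m
count-memberOf {m} (v ∷ L) (v∉L ∷ unique) = begin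
  sumCube m (λ x → 𝟙 (does (x ≟ᵛ v) ∨ memberOf L x))
    ≡⟨ sumCube-cong m (λ x → 𝟙-∨-disjoint (does (x ≟ᵛ v)) (memberOf L x) (disjoint x)) ⟩
  sumCube m (λ x → 𝟙 (does (x ≟ᵛ v)) + 𝟙 (memberOf L x))
    ≡⟨ sumCube-+ m (λ x → 𝟙 (does (x ≟ᵛ v))) (λ x → 𝟙 (memberOf L x)) ⟩
  count (λ x → does (x ≟ᵛ v)) + count (memberOf L)
    ≡⟨ cong₂ _+_ (count-point v) (count-memberOf L unique) ⟩
  suc (length L)
    ∎
  where
  open ≡-Reasoning
  disjoint : ∀ x → does (x ≟ᵛ v) ∧ memberOf L x ≡ false
  disjoint x with x ≟ᵛ v
  ... | no  _    = refl
  ... | yes refl with any? (x ≟ᵛ_) L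
  ...   | no  _   = refl
  ...   | yes x∈L = ⊥-elim (All¬⇒¬Any v∉L x∈L)

-- Shearer's lemma

countᴸ : ∀ {A : Set} → (A → Bool) → List A → ℕ
countᴸ p xs = sum (map (λ x → 𝟙 (p x)) xs)

countᴸ-++ : ∀ {A : Set} (p : A → Bool) xs ys → countᴸ p (xs ++ ys) ≡ countᴸ p xs + countᴸ p ys
countᴸ-++ p xs ys = trans (cong sum (map-++ _ xs ys)) (sum-++ (map _ xs) _)

countᴸ-map : ∀ {A B : Set} (p : B → Bool) (f : A → B) xs → countᴸ p (map f xs) ≡ countᴸ (p ∘ f) xs
countᴸ-map p f xs = cong sum (sym (map-∘ xs))

countᴸ-cong : ∀ {A : Set} {p q : A → Bool} → (∀ x → p x ≡ q x) → ∀ xs → countᴸ p xs ≡ countᴸ q xs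
countᴸ-cong p≗q xs = cong sum (map-cong (cong 𝟙 ∘ p≗q) xs)

countᴸ-const : ∀ {A : Set} b (xs : List A) → countᴸ (λ _ → b) xs ≡ 𝟙 b * length xs
countᴸ-const b []       = sym (*-zeroʳ (𝟙 b))
countᴸ-const b (x ∷ xs) = trans (cong (𝟙 b +_) (countᴸ-const b xs)) (sym (*-suc (𝟙 b) (length xs)))

countᴸ-concat-tabulate : ∀ {A : Set} (p : A → Bool) {k} (h : Fin k → List A) →
                         countᴸ p (concat (tabulate h)) ≡ sum (tabulate (countᴸ p ∘ h))
countᴸ-concat-tabulate p {zero}  h = refl
countᴸ-concat-tabulate p {suc k} h =
  trans (countᴸ-++ p (h zero) _) (cong (countᴸ p (h zero) +_) (countᴸ-concat-tabulate p (h ∘ suc)))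

coverage : ∀ {m} → List (Vec Bool m) → Fin m → ℕ
coverage Ss i = countᴸ (λ S → lookup S i) Ss

cylinderProduct : ∀ {m} → (Vec Bool m → Bool) → List (Vec Bool m) → ℕ
cylinderProduct F Ss = product (map (λ S → count (cylinder S F)) Ss)

restrict : ∀ {m} → Bool → (Vec Bool (suc m) → Bool) → Vec Bool m → Bool
restrict b F x = F (b ∷ x)

pick : Bool → ℕ × ℕ → ℕ
pick false = proj₁
pick true  = proj₂

-- The induction step splits F along the first coordinate.  A set S = true ∷ S′ has a cylinder count that
-- is the sum of those of the two halves F₀, F₁ (headPairs); a set S = false ∷ S′ has twice the count of
-- the union of the cylinders of F₀ and F₁ over S′ (avoiding, unionCount).
module _ {m : ℕ} (F : Vec Bool (suc m) → Bool) where

  private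
    F₀ F₁ : Vec Bool m → Bool
    F₀ = restrict false F
    F₁ = restrict true F

  headPairs : List (Vec Bool (suc m)) → List (ℕ × ℕ)
  headPairs []                 = []
  headPairs ((true ∷ S) ∷ Ss)  = (count (cylinder S F₀) , count (cylinder S F₁)) ∷ headPairs Ss
  headPairs ((false ∷ S) ∷ Ss) = headPairs Ss

  avoiding : List (Vec Bool (suc m)) → List (Vec Bool m)
  avoiding []                 = []
  avoiding ((true ∷ S) ∷ Ss)  = avoiding Ss
  avoiding ((false ∷ S) ∷ Ss) = S ∷ avoiding Ss

  unionCount : Vec Bool m → ℕ
  unionCount S = count (λ x → cylinder S F₀ x ∨ cylinder S F₁ x)

  cylinderProduct-split : ∀ Ss → cylinderProduct F Ss ≡
    product (map total (headPairs Ss)) * (2 ^ length (avoiding Ss) * product (map unionCount (avoiding Ss)))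
  cylinderProduct-split []                 = refl
  cylinderProduct-split ((true ∷ S) ∷ Ss)  =
    trans (cong (total (count (cylinder S F₀) , count (cylinder S F₁)) *_) (cylinderProduct-split Ss))
          (sym (*-assoc (count (cylinder S F₀) + count (cylinder S F₁)) _ _))
  cylinderProduct-split ((false ∷ S) ∷ Ss) =
    trans (cong ((unionCount S + unionCount S) *_) (cylinderProduct-split Ss))
          (e (unionCount S) (product (map total (headPairs Ss))) (2 ^ length (avoiding Ss))
             (product (map unionCount (avoiding Ss))))
    where
    e : ∀ c w p f → (c + c) * (w * (p * f)) ≡ w * (2 * p * (c * f))
    e = solve-∀

  cylinderProduct-restrict : ∀ b Ss → cylinderProduct (restrict b F) (map tail Ss) ≤
    product (map (pick b) (headPairs Ss)) * product (map unionCount (avoiding Ss))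
  cylinderProduct-restrict b []                 = ≤-refl
  cylinderProduct-restrict b ((true ∷ S) ∷ Ss)  = begin
    count (cylinder S (restrict b F)) * cylinderProduct (restrict b F) (map tail Ss)
      ≤⟨ *-monoʳ-≤ (count (cylinder S (restrict b F))) (cylinderProduct-restrict b Ss) ⟩
    count (cylinder S (restrict b F)) * (A * R)   ≡⟨ *-assoc (count (cylinder S (restrict b F))) A R ⟨
    count (cylinder S (restrict b F)) * A * R     ≡⟨ cong (λ c → c * A * R) (pick-restrict b) ⟩
    pick b (count (cylinder S F₀) , count (cylinder S F₁)) * A * R ∎
    where
    open ≤-Reasoning
    A = product (map (pick b) (headPairs Ss))
    R = product (map unionCount (avoiding Ss))
    pick-restrict : ∀ b → count (cylinder S (restrict b F)) ≡ pick b (count (cylinder S F₀) , count (cylinder S F₁))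
    pick-restrict false = refl
    pick-restrict true  = refl
  cylinderProduct-restrict b ((false ∷ S) ∷ Ss) = begin
    count (cylinder S (restrict b F)) * cylinderProduct (restrict b F) (map tail Ss)
      ≤⟨ *-mono-≤ (sumCube-mono m (λ x → 𝟙-restrict b x)) (cylinderProduct-restrict b Ss) ⟩
    unionCount S * (A * R)                ≡⟨ e (unionCount S) A R ⟩
    A * (unionCount S * R)                ∎
    where
    open ≤-Reasoning
    A = product (map (pick b) (headPairs Ss))
    R = product (map unionCount (avoiding Ss))
    𝟙-restrict : ∀ b x → 𝟙 (cylinder S (restrict b F) x) ≤ 𝟙 (cylinder S F₀ x ∨ cylinder S F₁ x)
    𝟙-restrict false x = 𝟙-∨ˡ (cylinder S F₀ x) (cylinder S F₁ x)
    𝟙-restrict true  x = 𝟙-∨ʳ (cylinder S F₀ x) (cylinder S F₁ x)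
    e : ∀ c a f → c * (a * f) ≡ a * (c * f)
    e = solve-∀

  length-headPairs : ∀ Ss → length (headPairs Ss) ≡ coverage Ss zero
  length-headPairs []                 = refl
  length-headPairs ((true ∷ S) ∷ Ss)  = cong suc (length-headPairs Ss)
  length-headPairs ((false ∷ S) ∷ Ss) = length-headPairs Ss

  length-headPairs+avoiding : ∀ Ss → length (headPairs Ss) + length (avoiding Ss) ≡ length Ss
  length-headPairs+avoiding []                 = refl
  length-headPairs+avoiding ((true ∷ S) ∷ Ss)  = cong suc (length-headPairs+avoiding Ss)
  length-headPairs+avoiding ((false ∷ S) ∷ Ss) = trans (+-suc _ _) (cong suc (length-headPairs+avoiding Ss))

coverage-tail : ∀ {m} (Ss : List (Vec Bool (suc m))) i → coverage (map tail Ss) i ≡ coverage Ss (suc i)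
coverage-tail []             i = refl
coverage-tail ((b ∷ S) ∷ Ss) i = cong (𝟙 (lookup S i) +_) (coverage-tail Ss i)

-- Shearer's lemma |F| ^ K ≤ ∏_{S ∈ Ss} |proj_S F|, stated for cylinders: count (cylinder S F) is
-- 2 ^ (m - |S|) · |proj_S F| and the |S| add up to m * K.
shearer : ∀ m K .{{_ : NonZero K}} (Ss : List (Vec Bool m)) → (∀ i → coverage Ss i ≡ K) → ∀ F →
          count F ^ K * 2 ^ (m * length Ss) ≤ cylinderProduct F Ss * 2 ^ (m * K)
shearer zero (suc K) Ss _ F with F [] in F[]≡
... | false = z≤n
... | true  = ≤-reflexive (begin
  1 ^ suc K * 1            ≡⟨ *-identityʳ (1 ^ suc K) ⟩
  1 ^ suc K                ≡⟨ ^-zeroˡ (suc K) ⟩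
  1                        ≡⟨ product-one Ss ⟨
  cylinderProduct F Ss     ≡⟨ *-identityʳ (cylinderProduct F Ss) ⟨
  cylinderProduct F Ss * 1 ∎)
  where
  open ≡-Reasoning
  product-one : ∀ Ss → cylinderProduct F Ss ≡ 1
  product-one []        = refl
  product-one ([] ∷ Ss) rewrite F[]≡ = trans (*-identityˡ _) (product-one Ss)
shearer (suc m) K Ss covers F = begin
  (x + y) ^ K * 2 ^ (r + m * r)            ≡⟨ cong ((x + y) ^ K *_) (^-distribˡ-+-* 2 r (m * r)) ⟩
  (x + y) ^ K * (2 ^ r * M)                ≡⟨ cong (λ l → (x + y) ^ K * (2 ^ l * M)) r≡K+a ⟩
  (x + y) ^ K * (2 ^ (K + a) * M)          ≡⟨ cong (λ w → (x + y) ^ K * (w * M)) (^-distribˡ-+-* 2 K a) ⟩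
  (x + y) ^ K * (2 ^ K * 2 ^ a * M)        ≡⟨ e₁ ((x + y) ^ K) (2 ^ K) (2 ^ a) M ⟩
  2 ^ K * 2 ^ a * ((x + y) ^ K * M)        ≤⟨ *-monoʳ-≤ (2 ^ K * 2 ^ a) combined ⟩
  2 ^ K * 2 ^ a * (W * (R * 2 ^ (m * K)))  ≡⟨ e₂ (2 ^ K) (2 ^ a) W R (2 ^ (m * K)) ⟩
  W * (2 ^ a * R) * (2 ^ K * 2 ^ (m * K))  ≡⟨ cong₂ _*_ (cylinderProduct-split F Ss) (^-distribˡ-+-* 2 K (m * K)) ⟨
  cylinderProduct F Ss * 2 ^ (K + m * K)   ∎
  where
  open ≤-Reasoning
  x = count (restrict false F)
  y = count (restrict true F)
  r = length Ss
  M = 2 ^ (m * r)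
  ps = headPairs F Ss
  a = length (avoiding F Ss)
  W = product (map total ps)
  R = product (map (unionCount F) (avoiding F Ss))
  #ps≡K : length ps ≡ K
  #ps≡K = trans (length-headPairs F Ss) (covers zero)
  r≡K+a : r ≡ K + a
  r≡K+a = trans (sym (length-headPairs+avoiding F Ss)) (cong (_+ a) #ps≡K)
  half : ∀ b → count (restrict b F) ^ length ps * M ≤ product (map (pick b) ps) * (R * 2 ^ (m * K))
  half b = begin
    count (restrict b F) ^ length ps * M
      ≡⟨ cong₂ (λ k l → count (restrict b F) ^ k * 2 ^ (m * l)) #ps≡K (sym (length-map tail Ss)) ⟩
    count (restrict b F) ^ K * 2 ^ (m * length (map tail Ss))
      ≤⟨ shearer m K (map tail Ss) (λ i → trans (coverage-tail Ss i) (covers (suc i))) (restrict b F) ⟩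
    cylinderProduct (restrict b F) (map tail Ss) * 2 ^ (m * K)
      ≤⟨ *-monoˡ-≤ (2 ^ (m * K)) (cylinderProduct-restrict F b Ss) ⟩
    product (map (pick b) ps) * R * 2 ^ (m * K)
      ≡⟨ *-assoc (product (map (pick b) ps)) R (2 ^ (m * K)) ⟩
    product (map (pick b) ps) * (R * 2 ^ (m * K)) ∎
  combined : (x + y) ^ K * M ≤ W * (R * 2 ^ (m * K))
  combined = subst (λ k → (x + y) ^ k * M ≤ W * (R * 2 ^ (m * K))) #ps≡K
                   (holder ps M (R * 2 ^ (m * K)) (half false) (half true))
  e₁ : ∀ s a b M → s * (a * b * M) ≡ a * b * (s * M)
  e₁ = solve-∀
  e₂ : ∀ a b W f q → a * b * (W * (f * q)) ≡ W * (b * f) * (a * q)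
  e₂ = solve-∀

cylinderProduct-intersecting : ∀ {m} (F : Vec Bool m → Bool) Ss → All (λ S → IntersectingOn S F) Ss →
                               cylinderProduct F Ss * 2 ^ length Ss ≤ 2 ^ (m * length Ss)
cylinderProduct-intersecting {m} F []       []                  = ≤-reflexive (cong (2 ^_) (sym (*-zeroʳ m)))
cylinderProduct-intersecting {m} F (S ∷ Ss) (intersecting ∷ rest) = begin
  count (cylinder S F) * R * (2 * 2 ^ l)   ≡⟨ e (count (cylinder S F)) R (2 ^ l) ⟩
  2 * count (cylinder S F) * (R * 2 ^ l)   ≤⟨ *-mono-≤ (count-cylinder-intersecting S F intersecting)
                                                       (cylinderProduct-intersecting F Ss rest) ⟩
  2 ^ m * 2 ^ (m * l)                      ≡⟨ ^-distribˡ-+-* 2 m (m * l) ⟨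
  2 ^ (m + m * l)                          ≡⟨ cong (2 ^_) (*-suc m l) ⟨
  2 ^ (m * suc l)                          ∎
  where
  open ≤-Reasoning
  R = cylinderProduct F Ss
  l = length Ss
  e : ∀ a R q → a * R * (2 * q) ≡ 2 * a * (R * q)
  e = solve-∀

count-intersecting-cover : ∀ m K .{{_ : NonZero K}} (Ss : List (Vec Bool m)) F → (∀ i → coverage Ss i ≡ K) →
                           All (λ S → IntersectingOn S F) Ss → count F ^ K * 2 ^ length Ss ≤ 2 ^ (m * K)
count-intersecting-cover m K Ss F covers intersecting = *-cancelʳ-≤ _ _ (2 ^ (m * r)) {{m^n≢0 2 (m * r)}} (begin
  count F ^ K * 2 ^ r * 2 ^ (m * r)              ≡⟨ e₁ (count F ^ K) (2 ^ r) (2 ^ (m * r)) ⟩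
  2 ^ r * (count F ^ K * 2 ^ (m * r))            ≤⟨ *-monoʳ-≤ (2 ^ r) (shearer m K Ss covers F) ⟩
  2 ^ r * (cylinderProduct F Ss * 2 ^ (m * K))   ≡⟨ e₂ (cylinderProduct F Ss) (2 ^ r) (2 ^ (m * K)) ⟩
  cylinderProduct F Ss * 2 ^ r * 2 ^ (m * K)     ≤⟨ *-monoˡ-≤ (2 ^ (m * K))
                                                              (cylinderProduct-intersecting F Ss intersecting) ⟩
  2 ^ (m * r) * 2 ^ (m * K)                      ≡⟨ *-comm (2 ^ (m * r)) (2 ^ (m * K)) ⟩
  2 ^ (m * K) * 2 ^ (m * r)                      ∎)
  where
  open ≤-Reasoning
  r = length Ss
  e₁ : ∀ x y z → x * y * z ≡ y * (x * z)
  e₁ = solve-∀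
  e₂ : ∀ p a b → a * (p * b) ≡ p * a * b
  e₂ = solve-∀

-- Graphs as points of the cube

triangular : ℕ → ℕ
triangular zero    = 0
triangular (suc n) = n + triangular n

triangular≡C2 : ∀ n → triangular n ≡ n C 2
triangular≡C2 zero    = refl
triangular≡C2 (suc n) = trans (cong₂ _+_ (sym (nC1≡n n)) (triangular≡C2 n)) (nCk+nC[k+1]≡[n+1]C[k+1] n 1)

edges : ∀ n → Vec (Fin n × Fin n) (triangular n)
edges zero    = []
edges (suc n) = Vec.tabulate (λ i → zero , suc i) Vec.++ Vec.map (Product.map suc suc) (edges n)

edges-irreflexive : ∀ n → VecAll.All (λ e → proj₁ e ≢ proj₂ e) (edges n)
edges-irreflexive zero    = VecAll.[]
edges-irreflexive (suc n) =
  VecAll.++⁺ (VecAll.tabulate⁺ (λ i ())) (VecAll.map⁺ (VecAll.map (λ u≢v → u≢v ∘ Fin.suc-injective) (edges-irreflexive n)))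

Joins : ∀ {n} → Fin n × Fin n → Fin n → Fin n → Set
Joins e u v = e ≡ (u , v) ⊎ e ≡ (v , u)

lookup-edges-↑ˡ : ∀ n j → lookup (edges (suc n)) (j ↑ˡ triangular n) ≡ (zero , suc j)
lookup-edges-↑ˡ n j = trans (lookup-++ˡ (Vec.tabulate (λ i → zero , suc i)) _ j) (lookup∘tabulate _ j)

lookup-edges-↑ʳ : ∀ n e → lookup (edges (suc n)) (n ↑ʳ e) ≡ Product.map suc suc (lookup (edges n) e)
lookup-edges-↑ʳ n e = trans (lookup-++ʳ (Vec.tabulate (λ i → zero , suc i)) _ e) (lookup-map e _ (edges n))

edges-complete : ∀ n (u v : Fin n) → u ≢ v → Σ (Fin (triangular n)) λ e → Joins (lookup (edges n) e) u v
edges-complete (suc n) zero    zero    u≢v = ⊥-elim (u≢v refl)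
edges-complete (suc n) zero    (suc j) _   = j ↑ˡ triangular n , inj₁ (lookup-edges-↑ˡ n j)
edges-complete (suc n) (suc i) zero    _   = i ↑ˡ triangular n , inj₂ (lookup-edges-↑ˡ n i)
edges-complete (suc n) (suc i) (suc j) i≢j with edges-complete n i j (i≢j ∘ cong suc)
... | e , joins = n ↑ʳ e , Sum.map shift shift joins
  where
  shift : ∀ {p} → lookup (edges n) e ≡ p → lookup (edges (suc n)) (n ↑ʳ e) ≡ Product.map suc suc p
  shift p = trans (lookup-edges-↑ʳ n e) (cong (Product.map suc suc) p)

encode : ∀ {n} → (Fin n → Fin n → Bool) → Vec Bool (triangular n)
encode {n} A = Vec.map (uncurry A) (edges n)

IsSymmetric : ∀ {n} → (Fin n → Fin n → Bool) → Set
IsSymmetric A = ∀ i j → A i j ≡ A j i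

lookup-encode : ∀ {n} (A : Fin n → Fin n → Bool) e → lookup (encode A) e ≡ uncurry A (lookup (edges n) e)
lookup-encode {n} A e = lookup-map e (uncurry A) (edges n)

lookup-encode-joins : ∀ {n} {A : Fin n → Fin n → Bool} → IsSymmetric A →
                      ∀ {e u v} → Joins (lookup (edges n) e) u v → lookup (encode A) e ≡ A u v
lookup-encode-joins {A = A} _     {e}         (inj₁ p) = trans (lookup-encode A e) (cong (uncurry A) p)
lookup-encode-joins {A = A} sym-A {e} {u} {v} (inj₂ p) = trans (lookup-encode A e) (trans (cong (uncurry A) p) (sym-A v u))

code : ∀ {n} → Graph n → Vec Bool (triangular n)
code G = encode (adj G)

code-injective : ∀ {n} (G H : Graph n) → code G ≡ code H → SameGraph G H
code-injective G H codeG≡codeH u v with u ≟ v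
... | yes refl = trans (irrefl G u) (sym (irrefl H u))
... | no  u≢v  with edges-complete _ u v u≢v
...   | e , joins = begin
  adj G u v            ≡⟨ lookup-encode-joins (Graph.sym G) joins ⟨
  lookup (code G) e    ≡⟨ cong (λ w → lookup w e) codeG≡codeH ⟩
  lookup (code H) e    ≡⟨ lookup-encode-joins (Graph.sym H) joins ⟩
  adj H u v            ∎
  where open ≡-Reasoning

-- Colourings

sum-tabulate-const : ∀ c k → sum (tabulate {n = c} (λ _ → k)) ≡ c * k
sum-tabulate-const zero    k = refl
sum-tabulate-const (suc c) k = cong (k +_) (sum-tabulate-const c k)

sum-tabulate-δ : ∀ {c} (a : Fin c) k → sum (tabulate (λ b → 𝟙 (does (b ≟ a)) * k)) ≡ k
sum-tabulate-δ {suc c} zero    k = trans (cong₂ _+_ (+-identityʳ k) (trans (sum-tabulate-const c 0) (*-zeroʳ c))) (+-identityʳ k)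
sum-tabulate-δ {suc c} (suc a) k = sum-tabulate-δ a k

≟-sym : ∀ {c} (a b : Fin c) → does (a ≟ b) ≡ does (b ≟ a)
≟-sym a b with a ≟ b | b ≟ a
... | yes _   | yes _   = refl
... | no  _   | no  _   = refl
... | yes a≡b | no  b≢a = ⊥-elim (b≢a (sym a≡b))
... | no  a≢b | yes b≡a = ⊥-elim (a≢b (sym b≡a))

module _ (c : ℕ) where

  colourings : ∀ n → List (Vec (Fin c) n)
  colourings zero    = [] ∷ []
  colourings (suc n) = concat (tabulate (λ a → map (a ∷_) (colourings n)))

  countᴸ-colourings-suc : ∀ {n} p → countᴸ p (colourings (suc n)) ≡
                          sum (tabulate (λ a → countᴸ (λ P → p (a ∷ P)) (colourings n)))
  countᴸ-colourings-suc {n} p = trans (countᴸ-concat-tabulate p (λ a → map (a ∷_) (colourings n)))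
                                      (cong sum (tabulate-cong (λ a → countᴸ-map p (a ∷_) (colourings n))))

  sum-tabulate-≡const : ∀ {f : Fin c → ℕ} k → (∀ a → f a ≡ k) → sum (tabulate f) ≡ c * k
  sum-tabulate-≡const k f≡k = trans (cong sum (tabulate-cong f≡k)) (sum-tabulate-const c k)

  length-colourings : ∀ n → length (colourings n) ≡ c ^ n
  length-colourings n = trans (sym (trans (countᴸ-const true (colourings n)) (+-identityʳ _))) (count-all n)
    where
    count-all : ∀ n → countᴸ (λ _ → true) (colourings n) ≡ c ^ n
    count-all zero    = refl
    count-all (suc n) = trans (countᴸ-colourings-suc _) (sum-tabulate-≡const (c ^ n) (λ _ → count-all n))

  colourings-fixing : ∀ n (w : Fin (suc n)) a → countᴸ (λ P → does (lookup P w ≟ a)) (colourings (suc n)) ≡ c ^ n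
  colourings-fixing n zero a = begin
    countᴸ (λ P → does (lookup P zero ≟ a)) (colourings (suc n))
      ≡⟨ countᴸ-colourings-suc _ ⟩
    sum (tabulate (λ b → countᴸ (λ _ → does (b ≟ a)) (colourings n)))
      ≡⟨ cong sum (tabulate-cong (λ b → countᴸ-const (does (b ≟ a)) (colourings n))) ⟩
    sum (tabulate (λ b → 𝟙 (does (b ≟ a)) * length (colourings n)))
      ≡⟨ sum-tabulate-δ a _ ⟩
    length (colourings n)
      ≡⟨ length-colourings n ⟩
    c ^ n
      ∎
    where open ≡-Reasoning
  colourings-fixing (suc n) (suc w) a =
    trans (countᴸ-colourings-suc _) (sum-tabulate-≡const (c ^ n) (λ _ → colourings-fixing n w a))

  colourings-agreeing : ∀ n (u v : Fin (suc n)) → u ≢ v →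
                        countᴸ (λ P → does (lookup P u ≟ lookup P v)) (colourings (suc n)) ≡ c ^ n
  colourings-agreeing n       zero    zero    u≢v = ⊥-elim (u≢v refl)
  colourings-agreeing (suc n) zero    (suc v) _   = trans (countᴸ-colourings-suc _) (sum-tabulate-≡const (c ^ n)
    (λ b → trans (countᴸ-cong (λ P → ≟-sym b (lookup P v)) (colourings (suc n))) (colourings-fixing n v b)))
  colourings-agreeing (suc n) (suc u) zero    u≢v =
    trans (countᴸ-cong (λ P → ≟-sym (lookup P (suc u)) (lookup P zero)) (colourings (suc (suc n))))
          (colourings-agreeing (suc n) zero (suc u) (u≢v ∘ sym))
  colourings-agreeing (suc n) (suc u) (suc v) u≢v =
    trans (countᴸ-colourings-suc _) (sum-tabulate-≡const (c ^ n) (λ _ → colourings-agreeing n u v (u≢v ∘ cong suc)))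

-- K_t-intersecting families

monochromatic : ∀ {c n} → Vec (Fin c) n → Vec Bool (triangular n)
monochromatic P = encode (λ u v → does (lookup P u ≟ lookup P v))

coverage-monochromatic : ∀ c n e → coverage (map monochromatic (colourings c (suc n))) e ≡ c ^ n
coverage-monochromatic c n e = begin
  countᴸ (λ S → lookup S e) (map monochromatic (colourings c (suc n)))
    ≡⟨ countᴸ-map (λ S → lookup S e) monochromatic (colourings c (suc n)) ⟩
  countᴸ (λ P → lookup (monochromatic P) e) (colourings c (suc n))
    ≡⟨ countᴸ-cong (λ P → lookup-encode (λ u v → does (lookup P u ≟ lookup P v)) e) (colourings c (suc n)) ⟩
  countᴸ (λ P → does (lookup P u ≟ lookup P v)) (colourings c (suc n))
    ≡⟨ colourings-agreeing c n u v u≢v ⟩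
  c ^ n
    ∎
  where
  open ≡-Reasoning
  u = proj₁ (lookup (edges (suc n)) e)
  v = proj₂ (lookup (edges (suc n)) e)
  u≢v : u ≢ v
  u≢v = VecAll.lookup⁺ (edges-irreflexive (suc n)) e

common-monochromatic-edge : ∀ {c n} (G₁ G₂ : Graph n) → ContainsKₜInIntersection (suc c) G₁ G₂ → (P : Vec (Fin c) n) →
  Σ (Fin (triangular n)) λ e → lookup (monochromatic P) e ≡ true × lookup (code G₁) e ≡ true × lookup (code G₂) e ≡ true
common-monochromatic-edge {c} {n} G₁ G₂ (f , f-injective , adjacent) P
  with Fin.pigeonhole (n<1+n c) (λ i → lookup P (f i))
... | a , b , a<b , same-colour with edges-complete n (f a) (f b) (Fin.<⇒≢ a<b ∘ f-injective)
...   | e , joins =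
  e , trans (lookup-encode-joins (λ i j → ≟-sym (lookup P i) (lookup P j)) joins)
            (dec-true (lookup P (f a) ≟ lookup P (f b)) same-colour)
    , trans (lookup-encode-joins (Graph.sym G₁) joins) (proj₁ (adjacent a b (Fin.<⇒≢ a<b)))
    , trans (lookup-encode-joins (Graph.sym G₂) joins) (proj₂ (adjacent a b (Fin.<⇒≢ a<b)))

members : ∀ {n} → List (Graph n) → Vec Bool (triangular n) → Bool
members 𝒢 = memberOf (map code 𝒢)

count-members : ∀ {n} (𝒢 : List (Graph n)) → DistinctFamily 𝒢 → count (members 𝒢) ≡ length 𝒢
count-members 𝒢 distinct = trans (count-memberOf (map code 𝒢) unique) (length-map code 𝒢)
  where
  unique : Unique (map code 𝒢)
  unique = AllPairs.map⁺ (AllPairs.map (λ {G} {H} G≉H → G≉H ∘ code-injective G H) distinct)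

members-intersecting : ∀ {c n} (𝒢 : List (Graph n)) → KIntersecting (suc c) 𝒢 →
                       ∀ (P : Vec (Fin c) n) → IntersectingOn (monochromatic P) (members 𝒢)
members-intersecting 𝒢 intersecting P z z′ z∈ z′∈
  with ∈-map⁻ code (memberOf-sound (map code 𝒢) z z∈) | ∈-map⁻ code (memberOf-sound (map code 𝒢) z′ z′∈)
... | G₁ , G₁∈𝒢 , refl | G₂ , G₂∈𝒢 , refl = common-monochromatic-edge G₁ G₂ (intersecting G₁ G₂ G₁∈𝒢 G₂∈𝒢) P

count-members-≤ : ∀ c n (𝒢 : List (Graph (suc n))) → KIntersecting (suc (suc c)) 𝒢 →
                  count (members 𝒢) ≤ 2 ^ (triangular (suc n) ∸ suc c)
count-members-≤ c n 𝒢 intersecting =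
  ^-*-2^-≤⇒≤-2^∸ K {{m^n≢0 (suc c) n}} (count (members 𝒢)) (suc c) (triangular (suc n)) (begin
  count (members 𝒢) ^ K * 2 ^ (suc c * K)   ≡⟨ cong (λ r → count (members 𝒢) ^ K * 2 ^ r) #Ss ⟨
  count (members 𝒢) ^ K * 2 ^ length Ss     ≤⟨ count-intersecting-cover _ K {{m^n≢0 (suc c) n}} Ss (members 𝒢)
                                                   (coverage-monochromatic (suc c) n)
                                                   (All.map⁺ (All.universal (members-intersecting 𝒢 intersecting) _)) ⟩
  2 ^ (triangular (suc n) * K)              ∎)
  where
  open ≤-Reasoning
  K = suc c ^ n
  Ss = map monochromatic (colourings (suc c) (suc n))
  #Ss : length Ss ≡ suc c * K
  #Ss = trans (length-map monochromatic (colourings (suc c) (suc n))) (length-colourings (suc c) (suc n))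

corollary1 : (t n : ℕ) → 2 ≤ t → 1 ≤ n → (𝒢 : List (Graph n)) →
    DistinctFamily 𝒢 → KIntersecting t 𝒢 →
    length 𝒢 ≤ 2 ^ ((n C 2) ∸ (t ∸ 1))
corollary1 (suc (suc c)) (suc n) (s≤s (s≤s z≤n)) (s≤s z≤n) 𝒢 distinct intersecting = begin
  length 𝒢                          ≡⟨ count-members 𝒢 distinct ⟨
  count (members 𝒢)                 ≤⟨ count-members-≤ c n 𝒢 intersecting ⟩
  2 ^ (triangular (suc n) ∸ suc c)  ≡⟨ cong (λ m → 2 ^ (m ∸ suc c)) (triangular≡C2 (suc n)) ⟩
  2 ^ (suc n C 2 ∸ suc c)           ∎
  where open ≤-Reasoning
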